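{- Let $G=(V,E)$ be an undirected graph with non-negative edge weights and $T$ a rooted spanning tree of $G$. Let $e$ be an edge of $T$ with lower endpoint $u$. Then there do not exist two edges $e',e''$ of $T$ with $e'\perp e''$ that are both cross-interesting with respect to $e$, and there do not exist two edges $e',e''$ of $T$ with $e'\perp e''$ that are both down-interesting with respect to $e$.
   Context: For a vertex $x$, $x^\downarrow$ denotes the vertex set of the subtree of $T$ rooted at $x$; for a tree edge whose endpoint farther from the root is $x$, we call $x$ its lower endpoint (and the edge the parent edge of $x$). For disjoint $S,S'\subseteq V$, $C(S,S')$ is the total weight of edges with one endpoint in $S$ and the other in $S'$, and $\deg(S)=C(S,V\setminus S)$. Two tree edges are orthogonal, written $e_1\perp e_2$, if they do not lie on a common root-to-leaf path of $T$. A tree edge $e'$ with lower endpoint $v$ is cross-interesting with respect to $e$ if $e\perp e'$ and $C(u^\downarrow,v^\downarrow)>\deg(u^\downarrow)/2$. A tree edge $e'$ with lower endpoint $v$, where $v\in u^\downarrow\setminus\{u\}$, is down-interesting with respect to $e$ if $C(v^\downarrow,V\setminus u^\downarrow)>\deg(u^\downarrow)/2$.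
   Formalization: The edge weights of G are non-negative rational numbers. -}

module Defs where

open import Data.Nat using (ℕ; zero; suc)
open import Data.Fin using (Fin; zero; suc; _≟_)
open import Data.Bool using (Bool; true; false; _∧_; not; if_then_else_)
open import Data.List using (List; []; _∷_)
open import Data.Bool.ListAction using (any)
open import Data.Rational using (ℚ; 0ℚ; _+_; _*_; _≤_; _<_; ½)
open import Data.Product using (_×_; Σ; ∃; _,_)
open import Relation.Nullary using (¬_; does)
open import Relation.Binary.PropositionalEquality using (_≡_; _≢_)

-- An undirected simple graph on vertex set Fin n with non-negative
-- (rational) edge weights.  adj i j says {i,j} ∈ E; w i j is its weight
-- (irrelevant when adj i j ≡ false).
record WGraph (n : ℕ) : Set where
  field
    adj        : Fin n → Fin n → Bool
    adj-sym    : ∀ i j → adj i j ≡ adj j i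
    adj-irrefl : ∀ i → adj i i ≡ false
    w          : Fin n → Fin n → ℚ
    w-sym      : ∀ i j → w i j ≡ w j i
    w-nonneg   : ∀ i j → 0ℚ ≤ w i j

-- A rooted tree on Fin n given by its root and parent pointers; every
-- vertex reaches the root by following parents (so the non-root vertices
-- with their parent edges form a spanning tree of Fin n).
module _ {n : ℕ} (root : Fin n) (parent : Fin n → Fin n) where
  data Reaches : Fin n → Set where
    here : Reaches root
    step : ∀ {v} → v ≢ root → Reaches (parent v) → Reaches v

record RootedTree (n : ℕ) : Set where
  field
    root    : Fin n
    parent  : Fin n → Fin n
    reaches : ∀ v → Reaches root parent v

IsSpanningTreeOf : {n : ℕ} → RootedTree n → WGraph n → Set
IsSpanningTreeOf T G = ∀ v → v ≢ RootedTree.root T → WGraph.adj G v (RootedTree.parent T v) ≡ true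

Subset : ℕ → Set
Subset n = Fin n → Bool

module TreeOps {n : ℕ} (T : RootedTree n) where
  open RootedTree T

  -- the path v, parent v, …, root (fuel k; fuel n suffices in a tree)
  pathUp : ℕ → Fin n → List (Fin n)
  pathUp zero v = v ∷ []
  pathUp (suc k) v = v ∷ (if does (v ≟ root) then [] else pathUp k (parent v))

  -- x ↓ : vertex set of the subtree rooted at x (v ∈ x↓ iff x is on the root path of v)
  _↓ : Fin n → Subset n
  (x ↓) v = any (λ y → does (y ≟ x)) (pathUp n v)

  -- tree edges are identified with their lower endpoints (non-root vertices);
  -- two tree edges lie on a common root-to-leaf path iff one lower endpoint is
  -- in the subtree of the other.
  _⊥_ : Fin n → Fin n → Set
  a ⊥ b = ((b ↓) a ≡ false) × ((a ↓) b ≡ false)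

module _ {n : ℕ} where
  sumFin : {m : ℕ} → (Fin m → ℚ) → ℚ
  sumFin {zero} f = 0ℚ
  sumFin {suc m} f = f zero + sumFin (λ i → f (suc i))

  compl : Subset n → Subset n
  compl S v = not (S v)

  -- C(S,S') : total weight of edges with one endpoint in S, the other in S'
  -- (for disjoint S, S' each such edge is counted exactly once).
  Cut : WGraph n → Subset n → Subset n → ℚ
  Cut G S S' = sumFin (λ i → sumFin (λ j →
    if S i ∧ S' j ∧ WGraph.adj G i j then WGraph.w G i j else 0ℚ))

  deg : WGraph n → Subset n → ℚ
  deg G S = Cut G S (compl S)

module Interesting {n : ℕ} (G : WGraph n) (T : RootedTree n) where
  open RootedTree T
  open TreeOps T

  CrossInteresting : Fin n → Fin n → Set
  CrossInteresting u v = v ≢ root × (u ⊥ v) × (½ * deg G (u ↓) < Cut G (u ↓) (v ↓))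

  DownInteresting : Fin n → Fin n → Set
  DownInteresting u v = v ≢ root × ((u ↓) v ≡ true) × (v ≢ u)
    × (½ * deg G (u ↓) < Cut G (v ↓) (compl (u ↓)))

{-# OPTIONS --safe #-}
-- Orthogonal tree edges have disjoint subtrees.  Hence for orthogonal v₁, v₂ the
-- edge sets u↓ × v₁↓ and u↓ × v₂↓ (both outside u↓ when v₁, v₂ are orthogonal to u),
-- resp. v₁↓ × (V ∖ u↓) and v₂↓ × (V ∖ u↓) (when v₁, v₂ lie below u), are disjoint
-- parts of the cut around u↓.  Their weights add up to at most deg(u↓), so they
-- cannot both exceed deg(u↓)/2.
module Submission where

open import Defs
open import Data.Nat using (ℕ; zero; suc)
open import Data.Fin using (Fin; zero; suc; _≟_; toℕ)
open import Data.Fin.Properties using (toℕ<n; toℕ-injective; injective⇒≤)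
open import Data.Bool using (Bool; true; false; _∧_; not; if_then_else_)
open import Data.Bool.Properties using (∨-zeroʳ; ¬-not)
open import Data.Bool.ListAction using (any)
open import Data.Product using (_×_; _,_; ∃₂; swap)
open import Data.Sum using (_⊎_; inj₁; inj₂)
open import Function using (_∘_)
open import Relation.Nullary using (¬_; yes; no; does; contradiction)
open import Relation.Nullary.Decidable using (dec-true; dec-false)
open import Relation.Binary.PropositionalEquality using (_≡_; _≢_; refl; sym; trans; cong; subst; module ≡-Reasoning)

module Subtrees {n : ℕ} (T : RootedTree n) where
  open import Data.Nat using (_+_; _≤_; _<_; s≤s⁻¹)
  open import Data.Nat.Properties using (+-identityʳ; +-suc; +-cancelˡ-≡; <⇒≤)
  open RootedTree T
  open TreeOps T

  length : ∀ {v} → Reaches root parent v → ℕ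
  length here       = 0
  length (step _ r) = suc (length r)

  length-unique : ∀ {v} (r r′ : Reaches root parent v) → length r ≡ length r′
  length-unique here         here         = refl
  length-unique here         (step v≢r _) = contradiction refl v≢r
  length-unique (step v≢r _) here         = contradiction refl v≢r
  length-unique (step _ r)   (step _ r′)  = cong suc (length-unique r r′)

  depth : Fin n → ℕ
  depth v = length (reaches v)

  depth-root : depth root ≡ 0
  depth-root = length-unique (reaches root) here

  depth-parent : ∀ {v} → v ≢ root → depth v ≡ suc (depth (parent v))
  depth-parent {v} v≢r = length-unique (reaches v) (step v≢r (reaches (parent v)))

  parent^ : ℕ → Fin n → Fin n
  parent^ zero    v = v
  parent^ (suc k) v = parent^ k (parent v)

  depth-parent^ : ∀ k v → k ≤ depth v → depth (parent^ k v) + k ≡ depth v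
  depth-parent^ zero    v _ = +-identityʳ (depth v)
  depth-parent^ (suc k) v k<d with v ≟ root
  ... | yes refl = contradiction (subst (suc k ≤_) depth-root k<d) λ ()
  ... | no v≢r   = begin
    depth (parent^ k (parent v)) + suc k   ≡⟨ +-suc _ k ⟩
    suc (depth (parent^ k (parent v)) + k) ≡⟨ cong suc (depth-parent^ k (parent v) k≤d′) ⟩
    suc (depth (parent v))                 ≡⟨ sym (depth-parent v≢r) ⟩
    depth v                                ∎
    where
    open ≡-Reasoning
    k≤d′ : k ≤ depth (parent v)
    k≤d′ = s≤s⁻¹ (subst (suc k ≤_) (depth-parent v≢r) k<d)

  -- Hence the fuel n in the definition of _↓ always suffices to reach the root.
  depth<n : ∀ v → depth v < n
  depth<n v = injective⇒≤ {f = ancestor} ancestor-injective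
    where
    ancestor : Fin (suc (depth v)) → Fin n
    ancestor i = parent^ (toℕ i) v
    toℕ≤depth : ∀ i → toℕ i ≤ depth v
    toℕ≤depth i = s≤s⁻¹ (toℕ<n i)
    ancestor-injective : ∀ {i j} → ancestor i ≡ ancestor j → i ≡ j
    ancestor-injective {i} {j} eq = toℕ-injective (+-cancelˡ-≡ (depth (ancestor i)) _ _ (begin
      depth (ancestor i) + toℕ i ≡⟨ depth-parent^ (toℕ i) v (toℕ≤depth i) ⟩
      depth v                    ≡⟨ sym (depth-parent^ (toℕ j) v (toℕ≤depth j)) ⟩
      depth (ancestor j) + toℕ j ≡⟨ cong (λ x → depth x + toℕ j) (sym eq) ⟩
      depth (ancestor i) + toℕ j ∎))
      where open ≡-Reasoning

  data Ancestor (x : Fin n) : Fin n → Set where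
    self : Ancestor x x
    up   : ∀ {v} → v ≢ root → Ancestor x (parent v) → Ancestor x v

  Ancestor-trans : ∀ {x y v} → Ancestor x y → Ancestor y v → Ancestor x v
  Ancestor-trans x≼y self         = x≼y
  Ancestor-trans x≼y (up v≢r y≼p) = up v≢r (Ancestor-trans x≼y y≼p)

  Ancestor-comparable : ∀ {x y v} → Ancestor x v → Ancestor y v → Ancestor x y ⊎ Ancestor y x
  Ancestor-comparable self         y≼v        = inj₂ y≼v
  Ancestor-comparable x≼v@(up _ _) self       = inj₁ x≼v
  Ancestor-comparable (up _ x≼p)   (up _ y≼p) = Ancestor-comparable x≼p y≼p

  onPathUp : Fin n → ℕ → Fin n → Bool
  onPathUp x k v = any (λ y → does (y ≟ x)) (pathUp k v)

  onPathUp-self : ∀ k v → onPathUp v k v ≡ true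
  onPathUp-self zero    v rewrite dec-true (v ≟ v) refl = refl
  onPathUp-self (suc k) v rewrite dec-true (v ≟ v) refl = refl

  onPathUp⇒Ancestor : ∀ {x} k v → onPathUp x k v ≡ true → Ancestor x v
  onPathUp⇒Ancestor {x} zero v on with v ≟ x
  ... | yes refl = self
  onPathUp⇒Ancestor {x} (suc k) v on with v ≟ x | v ≟ root
  ... | yes refl | _      = self
  ... | no _     | no v≢r = up v≢r (onPathUp⇒Ancestor k (parent v) on)

  Ancestor⇒onPathUp : ∀ {x v} k → Ancestor x v → depth v ≤ k → onPathUp x k v ≡ true
  Ancestor⇒onPathUp k       self         _   = onPathUp-self k _
  Ancestor⇒onPathUp zero    (up v≢r _)   d≤0 = contradiction (subst (_≤ 0) (depth-parent v≢r) d≤0) λ ()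
  Ancestor⇒onPathUp {x} {v} (suc k) (up v≢r x≼p) d≤k
    rewrite dec-false (v ≟ root) v≢r
          | Ancestor⇒onPathUp k x≼p (s≤s⁻¹ (subst (_≤ suc k) (depth-parent v≢r) d≤k))
    = ∨-zeroʳ (does (v ≟ x))

  ↓⇒Ancestor : ∀ {x v} → (x ↓) v ≡ true → Ancestor x v
  ↓⇒Ancestor = onPathUp⇒Ancestor n _

  Ancestor⇒↓ : ∀ {x v} → Ancestor x v → (x ↓) v ≡ true
  Ancestor⇒↓ {v = v} x≼v = Ancestor⇒onPathUp n x≼v (<⇒≤ (depth<n v))

  ↓-trans : ∀ {x y v} → (x ↓) y ≡ true → (y ↓) v ≡ true → (x ↓) v ≡ true
  ↓-trans x∋y y∋v = Ancestor⇒↓ (Ancestor-trans (↓⇒Ancestor x∋y) (↓⇒Ancestor y∋v))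

  ⊥⇒↓-disjoint : ∀ {a b v} → a ⊥ b → (a ↓) v ≡ true → (b ↓) v ≢ true
  ⊥⇒↓-disjoint (b∌a , a∌b) a∋v b∋v with Ancestor-comparable (↓⇒Ancestor a∋v) (↓⇒Ancestor b∋v)
  ... | inj₁ a≼b = contradiction (trans (sym (Ancestor⇒↓ a≼b)) a∌b) λ ()
  ... | inj₂ b≼a = contradiction (trans (sym (Ancestor⇒↓ b≼a)) b∌a) λ ()

  ⊥⇒↓⊆compl : ∀ {a b v} → a ⊥ b → (b ↓) v ≡ true → compl (a ↓) v ≡ true
  ⊥⇒↓⊆compl a⊥b b∋v = cong not (¬-not (⊥⇒↓-disjoint (swap a⊥b) b∋v))

open import Data.Rational using (ℚ; 0ℚ; _+_; _*_; _≤_; _<_; ½)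
import Data.Rational.Properties as ℚ
open import Algebra.Bundles using (CommutativeMonoid)
open import Algebra.Properties.CommutativeSemigroup
  (CommutativeMonoid.commutativeSemigroup ℚ.+-0-commutativeMonoid) using (interchange)

-- sumFin carries the unused parameter n of its enclosing anonymous module; it has to be
-- given explicitly.
sumFin-+-≤ : ∀ {n m} {f g h : Fin m → ℚ} → (∀ i → f i + g i ≤ h i) →
             sumFin {n} f + sumFin {n} g ≤ sumFin {n} h
sumFin-+-≤ {m = zero}  _     = ℚ.≤-refl
sumFin-+-≤ {n} {suc m} {f} {g} {h} fg≤h = begin
  (f zero + sumFin {n} (f ∘ suc)) + (g zero + sumFin {n} (g ∘ suc))
    ≡⟨ interchange (f zero) _ (g zero) _ ⟩
  (f zero + g zero) + (sumFin {n} (f ∘ suc) + sumFin {n} (g ∘ suc))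
    ≤⟨ ℚ.+-mono-≤ (fg≤h zero) (sumFin-+-≤ {n} (fg≤h ∘ suc)) ⟩
  h zero + sumFin {n} (h ∘ suc) ∎
  where open ℚ.≤-Reasoning

if-+-≤ : ∀ {c₁ c₂ c : Bool} {w : ℚ} → 0ℚ ≤ w →
         (c₁ ≡ true → c ≡ true) → (c₂ ≡ true → c ≡ true) → (c₁ ≡ true → c₂ ≢ true) →
         (if c₁ then w else 0ℚ) + (if c₂ then w else 0ℚ) ≤ (if c then w else 0ℚ)
if-+-≤ {true}  {true}          _   _    _    c₁#c₂ = contradiction refl (c₁#c₂ refl)
if-+-≤ {true}  {false}         _   c₁⇒c _    _ rewrite c₁⇒c refl = ℚ.≤-reflexive (ℚ.+-identityʳ _)
if-+-≤ {false} {true}          _   _    c₂⇒c _ rewrite c₂⇒c refl = ℚ.≤-reflexive (ℚ.+-identityˡ _)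
if-+-≤ {false} {false} {true}  0≤w _    _    _     = 0≤w
if-+-≤ {false} {false} {false} _   _    _    _     = ℚ.≤-refl

∧₃-true⁻ : ∀ {x y z} → x ∧ y ∧ z ≡ true → x ≡ true × y ≡ true × z ≡ true
∧₃-true⁻ {true} {true} {true} _ = refl , refl , refl

∧₃-true⁺ : ∀ {x y z} → x ≡ true → y ≡ true → z ≡ true → x ∧ y ∧ z ≡ true
∧₃-true⁺ refl refl refl = refl

module _ {n : ℕ} where
  _⊠_ : Subset n → Subset n → Fin n → Fin n → Set
  (A ⊠ B) i j = A i ≡ true × B j ≡ true

  Cut-+-≤ : (G : WGraph n) {A₁ B₁ A₂ B₂ A B : Subset n} →
            (∀ {i j} → (A₁ ⊠ B₁) i j → (A ⊠ B) i j) →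
            (∀ {i j} → (A₂ ⊠ B₂) i j → (A ⊠ B) i j) →
            (∀ {i j} → (A₁ ⊠ B₁) i j → ¬ (A₂ ⊠ B₂) i j) →
            Cut G A₁ B₁ + Cut G A₂ B₂ ≤ Cut G A B
  Cut-+-≤ G {A₁} {B₁} {A₂} {B₂} {A} {B} R₁⊆R R₂⊆R R₁#R₂ =
    sumFin-+-≤ {n} λ i → sumFin-+-≤ {n} λ j →
      if-+-≤ (w-nonneg i j) (edge-mono A₁ B₁ R₁⊆R) (edge-mono A₂ B₂ R₂⊆R)
        λ e₁ e₂ → R₁#R₂ (rectangle A₁ B₁ e₁) (rectangle A₂ B₂ e₂)
    where
    open WGraph G
    rectangle : ∀ A′ B′ {i j} → A′ i ∧ B′ j ∧ adj i j ≡ true → (A′ ⊠ B′) i j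
    rectangle _ _ e = let i∈ , j∈ , _ = ∧₃-true⁻ e in i∈ , j∈
    edge-mono : ∀ A′ B′ {i j} → ((A′ ⊠ B′) i j → (A ⊠ B) i j) →
                A′ i ∧ B′ j ∧ adj i j ≡ true → A i ∧ B j ∧ adj i j ≡ true
    edge-mono _ _ R′⊆R e =
      let i∈ , j∈ , ij∈E = ∧₃-true⁻ e
          i∈A , j∈B      = R′⊆R (i∈ , j∈)
      in  ∧₃-true⁺ i∈A j∈B ij∈E

not-both-exceed-half : ∀ {a b d} → a + b ≤ d → ¬ (½ * d < a × ½ * d < b)
not-both-exceed-half {d = d} a+b≤d (d/2<a , d/2<b) =
  ℚ.<-irrefl refl (ℚ.<-≤-trans d<a+b a+b≤d)
  where
  d<a+b : d < _
  d<a+b = subst (_< _) (trans (sym (ℚ.*-distribʳ-+ d ½ ½)) (ℚ.*-identityˡ d))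
                (ℚ.+-mono-< d/2<a d/2<b)

mainTheorem8 : ∀ {n : ℕ} (G : WGraph n) (T : RootedTree n) → IsSpanningTreeOf T G →
    (u : Fin n) → u ≢ RootedTree.root T →
    (¬ ∃₂ λ v₁ v₂ → TreeOps._⊥_ T v₁ v₂ × Interesting.CrossInteresting G T u v₁ × Interesting.CrossInteresting G T u v₂)
    × (¬ ∃₂ λ v₁ v₂ → TreeOps._⊥_ T v₁ v₂ × Interesting.DownInteresting G T u v₁ × Interesting.DownInteresting G T u v₂)
mainTheorem8 G T _ u _ = noCross , noDown
  where
  open TreeOps T
  open Subtrees T
  open Interesting G T

  noCross : ¬ ∃₂ λ v₁ v₂ → v₁ ⊥ v₂ × CrossInteresting u v₁ × CrossInteresting u v₂
  noCross (v₁ , v₂ , v₁⊥v₂ , (_ , u⊥v₁ , heavy₁) , (_ , u⊥v₂ , heavy₂)) =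
    not-both-exceed-half
      (Cut-+-≤ G {u ↓} {v₁ ↓} {u ↓} {v₂ ↓} {u ↓} {compl (u ↓)}
                 (λ (i∈u , j∈v₁) → i∈u , ⊥⇒↓⊆compl u⊥v₁ j∈v₁)
                 (λ (i∈u , j∈v₂) → i∈u , ⊥⇒↓⊆compl u⊥v₂ j∈v₂)
                 (λ (_ , j∈v₁) (_ , j∈v₂) → ⊥⇒↓-disjoint v₁⊥v₂ j∈v₁ j∈v₂))
      (heavy₁ , heavy₂)

  noDown : ¬ ∃₂ λ v₁ v₂ → v₁ ⊥ v₂ × DownInteresting u v₁ × DownInteresting u v₂
  noDown (v₁ , v₂ , v₁⊥v₂ , (_ , u∋v₁ , _ , heavy₁) , (_ , u∋v₂ , _ , heavy₂)) =
    not-both-exceed-half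
      (Cut-+-≤ G {v₁ ↓} {compl (u ↓)} {v₂ ↓} {compl (u ↓)} {u ↓} {compl (u ↓)}
                 (λ (i∈v₁ , j∉u) → ↓-trans u∋v₁ i∈v₁ , j∉u)
                 (λ (i∈v₂ , j∉u) → ↓-trans u∋v₂ i∈v₂ , j∉u)
                 (λ (i∈v₁ , _) (i∈v₂ , _) → ⊥⇒↓-disjoint v₁⊥v₂ i∈v₁ i∈v₂))
      (heavy₁ , heavy₂)
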